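{- Let $G$ be a graph whose node set is discrete. Then for all nodes $x,z$ and every walk $w:\mathsf{W}_G(x,z)$, $\mathsf{isQuasi}(w)$ is a decidable proposition.
   Context: Setting: homotopy type theory. A graph $G$: a set $\mathsf{N}_G$ of nodes and sets $\mathsf{E}_G(x,y)$ of edges; discrete means $\mathsf{N}_G$ has decidable equality. Walks: inductive family $\mathsf{W}_G(x,y)$ with $\langle x\rangle:\mathsf{W}_G(x,x)$ and $e\odot w:\mathsf{W}_G(x,z)$ for $e:\mathsf{E}_G(x,y)$, $w:\mathsf{W}_G(y,z)$. For a node $u$: $u\in\langle z\rangle:\equiv\mathbb{0}$, $u\in(e\odot w):\equiv(u=\mathsf{source}(e))+(u\in w)$. $\mathsf{isQuasi}(w):\equiv\prod_{u:\mathsf{N}_G}\mathsf{isProp}(u\in w)$. A type $A$ is decidable if $A+\neg A$ is inhabited. -}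

{-# OPTIONS --without-K #-}
module Defs where

open import Level using (Level; _⊔_; suc)
open import Relation.Binary.PropositionalEquality using (_≡_)
open import Relation.Binary.Definitions using (DecidableEquality)
open import Data.Empty using (⊥)
open import Data.Sum using (_⊎_)
open import Relation.Nullary using (¬_)

-- HoTT-style h-levels (stdlib is --without-K, so these are genuine conditions)
isProp : ∀ {a} → Set a → Set a
isProp A = (x y : A) → x ≡ y

isSet : ∀ {a} → Set a → Set a
isSet A = (x y : A) → isProp (x ≡ y)

isDecidable : ∀ {a} → Set a → Set a
isDecidable A = A ⊎ (¬ A)

record Graph (a b : Level) : Set (Level.suc (a ⊔ b)) where
  field
    N : Set a
    E : N → N → Set b
    N-isSet : isSet N
    E-isSet : (x y : N) → isSet (E x y)

module _ {a b} (G : Graph a b) where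
  open Graph G

  isDiscrete : Set a
  isDiscrete = DecidableEquality N

  data W : N → N → Set (a ⊔ b) where
    ⟨_⟩ : (x : N) → W x x
    _⊙_ : ∀ {x y z} → E x y → W y z → W x z

  _∈W_ : ∀ {x z} → N → W x z → Set a
  u ∈W ⟨ z ⟩ = Level.Lift a ⊥
  _∈W_ u (_⊙_ {x} e w) = (u ≡ x) ⊎ (u ∈W w)

  isQuasi : ∀ {x z} → W x z → Set a
  isQuasi w = (u : N) → isProp (u ∈W w)

{-# OPTIONS --safe #-}
module Submission where

open import Defs
open import Level using (Level; lower)
open import Function using (_∘_)
open import Data.Product using (_×_; _,_; uncurry)
open import Data.Sum using (_⊎_; inj₁; inj₂)
open import Data.Sum.Properties using (inj₂-injective)
open import Data.Empty using (⊥-elim)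
open import Relation.Nullary using (¬_; Dec; yes; no)
open import Relation.Nullary.Decidable using (map′; toSum; ¬?; _×-dec_; _⊎-dec_)
open import Relation.Binary.PropositionalEquality using (_≡_; refl; cong)
open import Axiom.Extensionality.Propositional using (Extensionality)
open import Axiom.UniquenessOfIdentityProofs using (module Constant⇒UIP)

private
  variable
    a b : Level
    A B : Set a

-- Hedberg: p x y, as a function of a path x ≡ y, is constant, and a constant endomap of paths forces UIP.
isProp⇒isSet : isProp A → isSet A
isProp⇒isSet p _ _ = Constant⇒UIP.≡-irrelevant (λ {x} {y} _ → p x y) (λ _ _ → refl)

isProp-isProp : Extensionality a a → {A : Set a} → isProp (isProp A)
isProp-isProp ext p q = ext λ x → ext λ y → isProp⇒isSet p x y (p x y) (q x y)

isProp-Π : Extensionality a b → {A : Set a} {B : A → Set b} →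
  ((x : A) → isProp (B x)) → isProp ((x : A) → B x)
isProp-Π ext B-prop f g = ext λ x → B-prop x (f x) (g x)

isProp-⊎ : isProp A → isProp B → (A → ¬ B) → isProp (A ⊎ B)
isProp-⊎ A-prop B-prop disjoint (inj₁ s) (inj₁ t) = cong inj₁ (A-prop s t)
isProp-⊎ A-prop B-prop disjoint (inj₁ s) (inj₂ t) = ⊥-elim (disjoint s t)
isProp-⊎ A-prop B-prop disjoint (inj₂ s) (inj₁ t) = ⊥-elim (disjoint t s)
isProp-⊎ A-prop B-prop disjoint (inj₂ s) (inj₂ t) = cong inj₂ (B-prop s t)

isProp-⊎⇒isPropʳ : isProp (A ⊎ B) → isProp B
isProp-⊎⇒isPropʳ p s t = inj₂-injective (p (inj₂ s) (inj₂ t))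

isProp-⊎⇒disjoint : isProp (A ⊎ B) → A → ¬ B
isProp-⊎⇒disjoint p s t with p (inj₁ s) (inj₂ t)
... | ()

module _ (G : Graph a b) where
  open Graph G

  ∈W? : isDiscrete G → ∀ {x z} (u : N) (w : W G x z) → Dec (_∈W_ G u w)
  ∈W? _≟_ u ⟨ _ ⟩         = no lower
  ∈W? _≟_ u (_⊙_ {x} e w) = (u ≟ x) ⊎-dec ∈W? _≟_ u w

  isQuasi-⟨⟩ : ∀ z → isQuasi G ⟨ z ⟩
  isQuasi-⟨⟩ z u ()

  isQuasi-⊙⁺ : ∀ {x y z} {e : E x y} {w : W G y z} →
    ¬ (_∈W_ G x w) → isQuasi G w → isQuasi G (e ⊙ w)
  isQuasi-⊙⁺ {x} x∉w w-quasi u =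
    isProp-⊎ (N-isSet u x) (w-quasi u) λ { refl → x∉w }

  isQuasi-⊙⁻ : ∀ {x y z} {e : E x y} {w : W G y z} →
    isQuasi G (e ⊙ w) → ¬ (_∈W_ G x w) × isQuasi G w
  isQuasi-⊙⁻ {x} ew-quasi =
    isProp-⊎⇒disjoint (ew-quasi x) refl , isProp-⊎⇒isPropʳ ∘ ew-quasi

  isQuasi? : isDiscrete G → ∀ {x z} (w : W G x z) → Dec (isQuasi G w)
  isQuasi? _≟_ ⟨ z ⟩         = yes (isQuasi-⟨⟩ z)
  isQuasi? _≟_ (_⊙_ {x} e w) =
    map′ (uncurry (isQuasi-⊙⁺ {e = e})) (isQuasi-⊙⁻ {e = e})
         (¬? (∈W? _≟_ x w) ×-dec isQuasi? _≟_ w)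

lemma4p14 : ∀ {a b} → Extensionality a a → (G : Graph a b) → isDiscrete G →
    ∀ {x z} (w : W G x z) → isProp (isQuasi G w) × isDecidable (isQuasi G w)
lemma4p14 ext G _≟_ w =
  isProp-Π ext (λ _ → isProp-isProp ext) , toSum (isQuasi? G _≟_ w)
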